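{- Let $p$ be an odd prime, $t\in\mathbb{N}$, $y,a_1,\dots,a_t\in\mathbb{Z}_p$ and $\alpha_j=\overline{(\alpha_{jk})}_k\in\mathcal{E}_p$ for $1\le j\le t$. Let $x_1\in\mathbb{Z}$ with $p\nmid x_1$ be such that (i) $f(x_1):=\sum_{j=1}^t a_jx_1^{\alpha_j}\equiv y\pmod p$, and (ii) $\sum_{j=1}^t a_j\,\alpha_{j2}\,x_1^{\alpha_j-1}\not\equiv 0\pmod p$. Then there exists a unique $x=\overline{(x_1,x_2,\dots)}\in\mathbb{Z}_p^\times$ (i.e. with first coordinate $x_1$) such that $f(x)=y$ in $\mathbb{Z}_p$.
   Context: $\mathbb{Z}_p$ is modeled as the set of sequences $(a_k)_{k\in\mathbb{N}}$ of integers with $a_{k+1}\equiv a_k\pmod{p^k}$, modulo $a_k\equiv b_k\pmod{p^k}$ for all $k$, with coordinatewise operations; units: $p\nmid a_1$; congruence modulo $p$ of an element of $\mathbb{Z}_p$ refers to its first coordinate. $\mathcal{E}_p$ is the set of sequences $(\alpha_k)_{k\in\mathbb{N}}$ of integers with $\alpha_{k+1}\equiv\alpha_k\pmod{\varphi(p^k)}$, modulo $\alpha_k\equiv\beta_k\pmod{\varphi(p^k)}$ for all $k$, coordinatewise operations ($\varphi$ = Euler's totient). For $a=\overline{(a_k)}\in\mathbb{Z}_p^\times$ and $\alpha=\overline{(\alpha_k)}\in\mathcal{E}_p$, $a^\alpha:=\overline{(a_k^{\alpha_k})}\in\mathbb{Z}_p^\times$; integers are embedded in $\mathbb{Z}_p$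 and $\mathcal{E}_p$ as constant sequences. -}

module Defs where

open import Data.Nat as ℕ using (ℕ; zero; suc)
open import Data.Fin using (Fin; zero; suc)
open import Data.Integer as ℤ using (ℤ; +_; _%ℕ_)
open import Data.Integer.Divisibility using () renaming (_∣_ to _∣ℤ_)
open import Data.Nat.Coprimality using (coprime?)
open import Data.List using (List; length; filter)
open import Data.List.Base using (upTo)
open import Data.Product using (Σ)
open import Relation.Nullary using (¬_)

_≡_[mod_] : ℤ → ℤ → ℕ → Set
a ≡ b [mod m ] = (+ m) ∣ℤ (a ℤ.- b)

φ : ℕ → ℕ
φ n = length (filter (λ i → coprime? (suc i) n) (upTo n))

-- Raw sequences. CONVENTION: index i : ℕ stands for the paper's index k = i + 1.
Seq : Set
Seq = ℕ → ℤ

record Zp (p : ℕ) : Set where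
  constructor mkZp
  field
    seq : Seq
    coh : ∀ i → seq (suc i) ≡ seq i [mod p ℕ.^ suc i ]
open Zp public

record Ep (p : ℕ) : Set where
  constructor mkEp
  field
    eseq : Seq
    ecoh : ∀ i → eseq (suc i) ≡ eseq i [mod φ (p ℕ.^ suc i) ]
open Ep public

_≈[_]_ : Seq → ℕ → Seq → Set
a ≈[ p ] b = ∀ i → a i ≡ b i [mod p ℕ.^ suc i ]

IsUnit : (p : ℕ) → Zp p → Set
IsUnit p a = ¬ ((+ p) ∣ℤ seq a 0)

const : ℤ → Seq
const z _ = z

_+ˢ_ : Seq → Seq → Seq
(a +ˢ b) i = a i ℤ.+ b i

_*ˢ_ : Seq → Seq → Seq
(a *ˢ b) i = a i ℤ.* b i

sumˢ : (t : ℕ) → (Fin t → Seq) → Seq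
sumˢ zero    s = const (+ 0)
sumˢ (suc t) s = s zero +ˢ sumˢ t (λ j → s (suc j))

-- reduction of an integer exponent to a natural representative modulo m
-- (m = φ(p^k) ≥ 1 in all uses; the value for m = 0 is irrelevant)
expMod : ℤ → ℕ → ℕ
expMod α zero    = 0
expMod α (suc m) = α %ℕ suc m

-- a^α := (a_k^{α_k}) where a_k^{α_k} is computed with the nonnegative
-- representative of α_k modulo φ(p^k) (well defined mod p^k for units a)
powˢ : ℕ → Seq → Seq → Seq
powˢ p a α i = a i ℤ.^ expMod (α i) (φ (p ℕ.^ suc i))

fˢ : (p t : ℕ) → (Fin t → Seq) → (Fin t → Seq) → Seq → Seq
fˢ p t a α x = sumˢ t (λ j → a j *ˢ powˢ p x (α j))

-- Σ_j a_j α_{j2} x^{α_j - 1}, as a sequence (α_{j2} = eseq index 1)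
f'ˢ : (p t : ℕ) → (Fin t → Seq) → (Fin t → Seq) → Seq → Seq
f'ˢ p t a α x = sumˢ t (λ j → (a j *ˢ const (α j 1))
                               *ˢ powˢ p x (λ i → α j i ℤ.- + 1))

-- At level i, i.e. modulo p ^ (i + 1), the function is the polynomial
-- f i z = Σ_j a_{j,i} z ^ e_{j,i}, where e_{j,i} is α_{j,i} reduced modulo φ (p ^ (i + 1)).
-- Euler's theorem x ^ φ (p ^ (i + 1)) ≡ 1 for p ∤ x (from φ (p ^ (i + 1)) = (p - 1) p ^ i and
-- Fermat's little theorem, itself a consequence of the binomial theorem) makes consecutive
-- levels agree on units. The derivative of f (i + 1) is congruent modulo p to the paper's
-- Σ_j a_j α_{j2} x₁ ^ (α_j - 1), hence invertible near x₁, so the Newton step z ↦ z + p ^ (i + 1) s,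
-- with s solving a linear congruence modulo p, lifts a root modulo p ^ (i + 1) to a root modulo
-- p ^ (i + 2), and this lift is unique modulo p ^ (i + 2).
module Submission where

open import Defs
open import Data.Nat using (ℕ)
open import Data.Nat.Divisibility using (_∣_)
open import Data.Nat.Primality using (Prime)
open import Data.Fin using (Fin)
open import Data.Integer using (ℤ; +_)
open import Data.Integer.Divisibility using () renaming (_∣_ to _∣ℤ_)
open import Data.Product using (Σ; _×_)
open import Relation.Nullary using (¬_)

open import Data.Fin as Fin using (zero; suc; toℕ; fromℕ; inject₁)
import Data.Fin.Properties as Fin
open import Data.Integer as ℤ using (0ℤ; 1ℤ; _+_; _*_; -_; _-_; _^_; _%ℕ_; _/ℕ_)
import Data.Integer.Properties as ℤ
open import Data.Integer.DivMod using (a≡a%ℕn+[a/ℕn]*n)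
import Data.Integer.Divisibility.Signed as Signed
open import Data.Integer.Tactic.RingSolver using (solve-∀)
open import Data.List using ([_]; _++_; length; filter; upTo)
open import Data.List.Properties using (upTo-∷ʳ; filter-++; length-++; filter-accept; filter-reject; filter-≐)
open import Data.Nat as ℕ using (zero; suc; NonZero; _∸_; _≤′_; ≤′-refl; ≤′-step)
open import Data.Nat.Combinatorics using (_C_; nCk+nC[k+1]≡[n+1]C[k+1]; nCn≡1; nCk≡nC[n∸k]; nC1≡n)
open import Data.Nat.Coprimality using (Coprime; coprime?; coprime-divisor)
open import Data.Nat.Divisibility as ℕ
  using (_∣?_; divides; ∣-refl; ∣-reflexive; ∣-trans; ∣1⇒≡1; ∣⇒≤; m∣m*n; n∣m*n; ∣n⇒∣m*n; ∣m+n∣m⇒∣n;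
         *-monoʳ-∣)
open import Data.Nat.Primality using (euclidsLemma; prime⇒irreducible; prime⇒nonZero; ¬prime[1])
import Data.Nat.Properties as ℕ
import Data.Nat.Tactic.RingSolver as ℕ-Solver
open import Data.Product using (_,_; proj₁; proj₂; map₂)
open import Data.Sum using (inj₁; inj₂)
open import Function using (_∘_)
open import Level using (Level; 0ℓ)
open import Relation.Binary.Bundles using (Setoid)
open import Relation.Binary.PropositionalEquality
  using (_≡_; refl; sym; trans; cong; cong₂; subst; subst₂; module ≡-Reasoning)
import Relation.Binary.Reasoning.Setoid as SetoidReasoning
open import Relation.Nullary using (¬?; contradiction)
open import Relation.Unary using (Pred; Decidable; _≐_)

open import Algebra.Properties.Semiring.Sum ℤ.+-*-semiring
  using (sum; sum-cong-≗; sum-init-last; sum-replicate-zero; ∑-distrib-+; *-distribˡ-sum)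
open import Algebra.Properties.Semiring.Mult ℤ.+-*-semiring using () renaming (_×_ to _×ₛ_)
open import Algebra.Properties.Semiring.Exp ℤ.+-*-semiring using () renaming (_^_ to _^ₛ_)
import Algebra.Properties.CommutativeSemiring.Binomial ℤ.+-*-commutativeSemiring as Binomial

infix 4 _≋_⟨mod_⟩

-- Unlike `a ≡ b [mod m ]`, whose unfolding forgets a and b, this record keeps them as indices,
-- so that Agda can infer them.
record _≋_⟨mod_⟩ (a b : ℤ) (m : ℕ) : Set where
  constructor ≋-by
  field
    quotient : ℤ
    equation : a ≡ b + quotient * + m

module _ {m : ℕ} where

  ≋-reflexive : ∀ {a b} → a ≡ b → a ≋ b ⟨mod m ⟩
  ≋-reflexive {a} refl = ≋-by 0ℤ (lemma a (+ m))
    where lemma : ∀ a m → a ≡ a + 0ℤ * m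
          lemma = solve-∀

  ≋-refl : ∀ {a} → a ≋ a ⟨mod m ⟩
  ≋-refl = ≋-reflexive refl

  ≋-sym : ∀ {a b} → a ≋ b ⟨mod m ⟩ → b ≋ a ⟨mod m ⟩
  ≋-sym {b = b} (≋-by q refl) = ≋-by (- q) (lemma b q (+ m))
    where lemma : ∀ b q m → b ≡ b + q * m + - q * m
          lemma = solve-∀

  ≋-trans : ∀ {a b c} → a ≋ b ⟨mod m ⟩ → b ≋ c ⟨mod m ⟩ → a ≋ c ⟨mod m ⟩
  ≋-trans {c = c} (≋-by q refl) (≋-by r refl) = ≋-by (r + q) (lemma c q r (+ m))
    where lemma : ∀ c q r m → c + r * m + q * m ≡ c + (r + q) * m
          lemma = solve-∀

  +-cong-mod : ∀ {a b c d} → a ≋ b ⟨mod m ⟩ → c ≋ d ⟨mod m ⟩ → a + c ≋ b + d ⟨mod m ⟩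
  +-cong-mod {b = b} {d = d} (≋-by q refl) (≋-by r refl) = ≋-by (q + r) (lemma b d q r (+ m))
    where lemma : ∀ b d q r m → b + q * m + (d + r * m) ≡ b + d + (q + r) * m
          lemma = solve-∀

  *-cong-mod : ∀ {a b c d} → a ≋ b ⟨mod m ⟩ → c ≋ d ⟨mod m ⟩ → a * c ≋ b * d ⟨mod m ⟩
  *-cong-mod {b = b} {d = d} (≋-by q refl) (≋-by r refl) =
    ≋-by (q * d + b * r + q * r * + m) (lemma b d q r (+ m))
    where lemma : ∀ b d q r m → (b + q * m) * (d + r * m) ≡ b * d + (q * d + b * r + q * r * m) * m
          lemma = solve-∀

  -‿cong-mod : ∀ {a b} → a ≋ b ⟨mod m ⟩ → - a ≋ - b ⟨mod m ⟩
  -‿cong-mod {b = b} (≋-by q refl) = ≋-by (- q) (lemma b q (+ m))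
    where lemma : ∀ b q m → - (b + q * m) ≡ - b + - q * m
          lemma = solve-∀

  ^-cong-mod : ∀ {a b} n → a ≋ b ⟨mod m ⟩ → a ^ n ≋ b ^ n ⟨mod m ⟩
  ^-cong-mod zero    _   = ≋-refl
  ^-cong-mod (suc n) a≋b = *-cong-mod a≋b (^-cong-mod n a≋b)

  +-cancelˡ-mod : ∀ a {b c} → a + b ≋ a + c ⟨mod m ⟩ → b ≋ c ⟨mod m ⟩
  +-cancelˡ-mod a {b} {c} (≋-by q eq) = ≋-by q (begin
    b                       ≡⟨ lemma₁ a b ⟩
    a + b - a               ≡⟨ cong (_- a) eq ⟩
    a + c + q * + m - a     ≡⟨ lemma₂ a c q (+ m) ⟩
    c + q * + m             ∎)
    where
    open ≡-Reasoning
    lemma₁ : ∀ a b → b ≡ a + b - a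
    lemma₁ = solve-∀
    lemma₂ : ∀ a c q m → a + c + q * m - a ≡ c + q * m
    lemma₂ = solve-∀

  ≋0-by : ∀ {a} q → a ≡ q * + m → a ≋ 0ℤ ⟨mod m ⟩
  ≋0-by q eq = ≋-by q (trans eq (sym (ℤ.+-identityˡ (q * + m))))

  ≢0-resp-≋ : ∀ {a b} → a ≋ b ⟨mod m ⟩ → ¬ b ≋ 0ℤ ⟨mod m ⟩ → ¬ a ≋ 0ℤ ⟨mod m ⟩
  ≢0-resp-≋ a≋b b≢0 a≋0 = b≢0 (≋-trans (≋-sym a≋b) a≋0)

≋-setoid : ℕ → Setoid 0ℓ 0ℓ
≋-setoid m = record
  { Carrier       = ℤ
  ; _≈_           = _≋_⟨mod m ⟩
  ; isEquivalence = record { refl = ≋-refl ; sym = ≋-sym ; trans = ≋-trans }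
  }

module ≋-Reasoning (m : ℕ) = SetoidReasoning (≋-setoid m)

≋-mod-∣ : ∀ {a b d m} → d ∣ m → a ≋ b ⟨mod m ⟩ → a ≋ b ⟨mod d ⟩
≋-mod-∣ {b = b} {d} (divides k refl) (≋-by q refl) =
  ≋-by (q * + k) (cong (_+_ b) (trans (cong (q *_) (ℤ.pos-* k d)) (sym (ℤ.*-assoc q (+ k) (+ d)))))

multiple≋0 : ∀ {m n} x → m ∣ n → + n * x ≋ 0ℤ ⟨mod m ⟩
multiple≋0 {m} x (divides k refl) =
  ≋0-by (+ k * x) (trans (cong (_* x) (ℤ.pos-* k m)) (lemma (+ k) (+ m) x))
  where lemma : ∀ k m x → k * m * x ≡ k * x * m
        lemma = solve-∀

*-≋0 : ∀ {a b m n} → a ≋ 0ℤ ⟨mod m ⟩ → b ≋ 0ℤ ⟨mod n ⟩ → a * b ≋ 0ℤ ⟨mod m ℕ.* n ⟩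
*-≋0 {m = m} {n} (≋-by q refl) (≋-by r refl) =
  ≋0-by (q * r) (trans (lemma q r (+ m) (+ n)) (cong (q * r *_) (sym (ℤ.pos-* m n))))
  where lemma : ∀ q r m n → (0ℤ + q * m) * (0ℤ + r * n) ≡ q * r * (m * n)
        lemma = solve-∀

*-scaleˡ-mod : ∀ {a b m} n → a ≋ b ⟨mod m ⟩ → + n * a ≋ + n * b ⟨mod m ℕ.* n ⟩
*-scaleˡ-mod {b = b} {m} n (≋-by q refl) =
  ≋-by q (trans (lemma (+ n) b q (+ m)) (cong (λ x → + n * b + q * x) (sym (ℤ.pos-* m n))))
  where lemma : ∀ n b q m → n * (b + q * m) ≡ n * b + q * (m * n)
        lemma = solve-∀

*-unscaleˡ-mod : ∀ {a b m} n .{{_ : NonZero n}} → + n * a ≋ + n * b ⟨mod m ℕ.* n ⟩ → a ≋ b ⟨mod m ⟩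
*-unscaleˡ-mod {a} {b} {m} n (≋-by q eq) = ≋-by q (ℤ.*-cancelˡ-≡ (+ n) a (b + q * + m) (begin
  + n * a                         ≡⟨ eq ⟩
  + n * b + q * + (m ℕ.* n)       ≡⟨ cong (λ x → + n * b + q * x) (ℤ.pos-* m n) ⟩
  + n * b + q * (+ m * + n)       ≡⟨ lemma (+ n) b q (+ m) ⟩
  + n * (b + q * + m)             ∎))
  where
  open ≡-Reasoning
  lemma : ∀ n b q m → n * b + q * (m * n) ≡ n * (b + q * m)
  lemma = solve-∀

≡[mod]⇒≋ : ∀ {a b m} → a ≡ b [mod m ] → a ≋ b ⟨mod m ⟩
≡[mod]⇒≋ {a} {b} m∣a-b with Signed.divides q eq ← Signed.∣ᵤ⇒∣ m∣a-b =
  ≋-by q (trans (lemma a b) (cong (_+_ b) eq))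
  where lemma : ∀ a b → a ≡ b + (a - b)
        lemma = solve-∀

≋⇒≡[mod] : ∀ {a b m} → a ≋ b ⟨mod m ⟩ → a ≡ b [mod m ]
≋⇒≡[mod] {b = b} {m} (≋-by q refl) = Signed.∣⇒∣ᵤ (Signed.divides q (lemma b (q * + m)))
  where lemma : ∀ b c → b + c - b ≡ c
        lemma = solve-∀

∣⇒≋0 : ∀ {a m} → + m ∣ℤ a → a ≋ 0ℤ ⟨mod m ⟩
∣⇒≋0 {a} {m} m∣a = ≡[mod]⇒≋ (subst (+ m ∣ℤ_) (sym (ℤ.+-identityʳ a)) m∣a)

≋0⇒∣ : ∀ {a m} → a ≋ 0ℤ ⟨mod m ⟩ → + m ∣ℤ a
≋0⇒∣ {a} {m} a≋0 = subst (+ m ∣ℤ_) (ℤ.+-identityʳ a) (≋⇒≡[mod] a≋0)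

+-≋⇒∣ : ∀ {e d N} → + (e ℕ.+ d) ≋ + e ⟨mod N ⟩ → N ∣ d
+-≋⇒∣ {e} {d} e+d≋e =
  ≋0⇒∣ {a = + d} (+-cancelˡ-mod (+ e) (≋-trans e+d≋e (≋-reflexive (sym (ℤ.+-identityʳ (+ e))))))

sumˢ-sum : ∀ t (s : Fin t → Seq) i → sumˢ t s i ≡ sum (λ j → s j i)
sumˢ-sum zero    s i = refl
sumˢ-sum (suc t) s i = cong (_+_ (s zero i)) (sumˢ-sum t (λ j → s (suc j)) i)

sum-cong-mod : ∀ {t m} {f g : Fin t → ℤ} → (∀ j → f j ≋ g j ⟨mod m ⟩) → sum f ≋ sum g ⟨mod m ⟩
sum-cong-mod {zero}  f≋g = ≋-refl
sum-cong-mod {suc t} f≋g = +-cong-mod (f≋g zero) (sum-cong-mod (λ j → f≋g (suc j)))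

sum-+-* : ∀ {t} (f g : Fin t → ℤ) h → sum (λ j → f j + h * g j) ≡ sum f + h * sum g
sum-+-* f g h = begin
  sum (λ j → f j + h * g j)         ≡⟨ ∑-distrib-+ f (λ j → h * g j) ⟩
  sum f + sum (λ j → h * g j)       ≡⟨ cong (_+_ (sum f)) (*-distribˡ-sum h g) ⟨
  sum f + h * sum g                 ∎
  where open ≡-Reasoning

powDeriv : ℕ → ℤ → ℤ
powDeriv e x = + e * x ^ (e ∸ 1)

powDeriv-suc : ∀ e x → powDeriv (suc e) x ≡ powDeriv e x * x + x ^ e
powDeriv-suc zero    x = lemma x
  where lemma : ∀ x → + 1 * 1ℤ ≡ + 0 * 1ℤ * x + 1ℤ
        lemma = solve-∀
powDeriv-suc (suc e) x = lemma (+ suc e) x (x ^ e)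
  where lemma : ∀ n x y → (1ℤ + n) * (x * y) ≡ n * y * x + x * y
        lemma = solve-∀

^-taylor : ∀ x h e → Σ ℤ λ c → (x + h) ^ e ≡ x ^ e + powDeriv e x * h + c * (h * h)
^-taylor x h zero = 0ℤ , lemma x h
  where lemma : ∀ x h → 1ℤ ≡ 1ℤ + + 0 * 1ℤ * h + 0ℤ * (h * h)
        lemma = solve-∀
^-taylor x h (suc e) with c , eq ← ^-taylor x h e = c′ , (begin
  (x + h) * (x + h) ^ e                                      ≡⟨ cong ((x + h) *_) eq ⟩
  (x + h) * (x ^ e + powDeriv e x * h + c * (h * h))         ≡⟨ expand x h (x ^ e) (powDeriv e x) c ⟩
  x ^ suc e + (powDeriv e x * x + x ^ e) * h + c′ * (h * h)
    ≡⟨ cong (λ d → x ^ suc e + d * h + c′ * (h * h)) (powDeriv-suc e x) ⟨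
  x ^ suc e + powDeriv (suc e) x * h + c′ * (h * h)          ∎)
  where
  open ≡-Reasoning
  c′ : ℤ
  c′ = x * c + powDeriv e x + c * h
  expand : ∀ x h y d c → (x + h) * (y + d * h + c * (h * h))
                         ≡ x * y + (d * x + y) * h + (x * c + d + c * h) * (h * h)
  expand = solve-∀

^-first-order-mod : ∀ {m} x {h} e → h * h ≋ 0ℤ ⟨mod m ⟩ →
                    (x + h) ^ e ≋ x ^ e + powDeriv e x * h ⟨mod m ⟩
^-first-order-mod {m} x {h} e h²≋0 with c , eq ← ^-taylor x h e = begin
  (x + h) ^ e         ≡⟨ eq ⟩
  y + c * (h * h)     ≈⟨ +-cong-mod (≋-refl {a = y}) (*-cong-mod (≋-refl {a = c}) h²≋0) ⟩
  y + c * 0ℤ          ≡⟨ cong (_+_ y) (ℤ.*-zeroʳ c) ⟩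
  y + 0ℤ              ≡⟨ ℤ.+-identityʳ y ⟩
  y                   ∎
  where
  open ≋-Reasoning m
  y : ℤ
  y = x ^ e + powDeriv e x * h

^-≋1-lift : ∀ {u m} n → n ∣ m → u ≋ 1ℤ ⟨mod m ⟩ → u ^ n ≋ 1ℤ ⟨mod n ℕ.* m ⟩
^-≋1-lift {m = m} n n∣m (≋-by q refl) = begin
  (1ℤ + h) ^ n                 ≈⟨ ^-first-order-mod 1ℤ n (*-≋0 (≋-mod-∣ n∣m h≋0) h≋0) ⟩
  1ℤ ^ n + powDeriv n 1ℤ * h   ≡⟨ cong (_+ powDeriv n 1ℤ * h) (ℤ.^-zeroˡ n) ⟩
  1ℤ + powDeriv n 1ℤ * h       ≈⟨ +-cong-mod (≋-refl {a = 1ℤ}) (*-≋0 n≋0 h≋0) ⟩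
  1ℤ + 0ℤ                      ≡⟨ ℤ.+-identityʳ 1ℤ ⟩
  1ℤ                           ∎
  where
  open ≋-Reasoning (n ℕ.* m)
  h : ℤ
  h = q * + m
  h≋0 : h ≋ 0ℤ ⟨mod m ⟩
  h≋0 = ≋0-by q refl
  n≋0 : + n * 1ℤ ^ (n ∸ 1) ≋ 0ℤ ⟨mod n ⟩
  n≋0 = multiple≋0 (1ℤ ^ (n ∸ 1)) (∣-refl {n})

^-*-≋1 : ∀ {x m} N → x ^ N ≋ 1ℤ ⟨mod m ⟩ → ∀ k → x ^ (k ℕ.* N) ≋ 1ℤ ⟨mod m ⟩
^-*-≋1 {x} {m} N x^N≋1 k = begin
  x ^ (k ℕ.* N)   ≡⟨ cong (x ^_) (ℕ.*-comm k N) ⟩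
  x ^ (N ℕ.* k)   ≡⟨ ℤ.^-*-assoc x N k ⟨
  (x ^ N) ^ k     ≈⟨ ^-cong-mod k x^N≋1 ⟩
  1ℤ ^ k          ≡⟨ ℤ.^-zeroˡ k ⟩
  1ℤ              ∎
  where open ≋-Reasoning m

private
  ^-cong-exponent-≤ : ∀ {x m N e e′} → x ^ N ≋ 1ℤ ⟨mod m ⟩ → e ℕ.≤ e′ →
                      + e′ ≋ + e ⟨mod N ⟩ → x ^ e′ ≋ x ^ e ⟨mod m ⟩
  ^-cong-exponent-≤ {x} {m} {N} {e} x^N≋1 e≤e′ e′≋e
    with d , refl ← ℕ.m≤n⇒∃[o]m+o≡n e≤e′
    with divides k refl ← +-≋⇒∣ {e} {d} e′≋e = begin
    x ^ (e ℕ.+ k ℕ.* N)       ≡⟨ ℤ.^-distribˡ-+-* x e (k ℕ.* N) ⟩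
    x ^ e * x ^ (k ℕ.* N)     ≈⟨ *-cong-mod (≋-refl {a = x ^ e}) (^-*-≋1 N x^N≋1 k) ⟩
    x ^ e * 1ℤ                ≡⟨ ℤ.*-identityʳ (x ^ e) ⟩
    x ^ e                     ∎
    where open ≋-Reasoning m

^-cong-exponent : ∀ {x m N e e′} → x ^ N ≋ 1ℤ ⟨mod m ⟩ →
                  + e ≋ + e′ ⟨mod N ⟩ → x ^ e ≋ x ^ e′ ⟨mod m ⟩
^-cong-exponent {e = e} {e′} x^N≋1 e≋e′ with ℕ.≤-total e e′
... | inj₁ e≤e′ = ≋-sym (^-cong-exponent-≤ x^N≋1 e≤e′ (≋-sym e≋e′))
... | inj₂ e′≤e = ^-cong-exponent-≤ x^N≋1 e′≤e e≋e′

powDeriv-cong-mod : ∀ {z x b m N e e′} → z ≋ x ⟨mod m ⟩ → x ^ N ≋ 1ℤ ⟨mod m ⟩ →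
                    + e ≋ b ⟨mod m ⟩ → + e - 1ℤ ≋ + e′ ⟨mod N ⟩ →
                    powDeriv e z ≋ b * x ^ e′ ⟨mod m ⟩
powDeriv-cong-mod {x = x} {b} {m} {e = zero} {e′} _ _ 0≋b _ = begin
  0ℤ              ≡⟨ ℤ.*-zeroˡ (x ^ e′) ⟨
  0ℤ * x ^ e′     ≈⟨ *-cong-mod 0≋b ≋-refl ⟩
  b * x ^ e′      ∎
  where open ≋-Reasoning m
powDeriv-cong-mod {z} {x} {b} {m} {N} {suc e} {e′} z≋x x^N≋1 1+e≋b 1+e-1≋e′ = begin
  + suc e * z ^ e   ≈⟨ *-cong-mod 1+e≋b (^-cong-mod e z≋x) ⟩
  b * x ^ e         ≈⟨ *-cong-mod (≋-refl {a = b}) (^-cong-exponent x^N≋1 e≋e′) ⟩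
  b * x ^ e′        ∎
  where
  open ≋-Reasoning m
  lemma : ∀ n → n ≡ 1ℤ + n - 1ℤ
  lemma = solve-∀
  e≋e′ : + e ≋ + e′ ⟨mod N ⟩
  e≋e′ = ≋-trans (≋-reflexive (lemma (+ e))) 1+e-1≋e′

-- Arithmetic modulo a prime

≢0*≋0⇒≋0 : ∀ {p a b} → Prime p → ¬ a ≋ 0ℤ ⟨mod p ⟩ →
            a * b ≋ 0ℤ ⟨mod p ⟩ → b ≋ 0ℤ ⟨mod p ⟩
≢0*≋0⇒≋0 {p} {a} {b} p-prime a≢0 ab≋0
  with euclidsLemma ℤ.∣ a ∣ ℤ.∣ b ∣ p-prime (subst (p ∣_) (ℤ.abs-* a b) (≋0⇒∣ ab≋0))
... | inj₁ p∣a = contradiction (∣⇒≋0 p∣a) a≢0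
... | inj₂ p∣b = ∣⇒≋0 p∣b

*-cancelˡ-mod-prime : ∀ {p a b c} → Prime p → ¬ a ≋ 0ℤ ⟨mod p ⟩ →
                      a * b ≋ a * c ⟨mod p ⟩ → b ≋ c ⟨mod p ⟩
*-cancelˡ-mod-prime {p} {a} {b} {c} p-prime a≢0 ab≋ac = begin
  b            ≡⟨ lemma₁ b c ⟩
  b - c + c    ≈⟨ +-cong-mod (≢0*≋0⇒≋0 p-prime a≢0 a[b-c]≋0) (≋-refl {a = c}) ⟩
  0ℤ + c       ≡⟨ ℤ.+-identityˡ c ⟩
  c            ∎
  where
  open ≋-Reasoning p
  lemma₁ : ∀ b c → b ≡ b - c + c
  lemma₁ = solve-∀
  lemma₂ : ∀ a b c → a * (b - c) ≡ a * b - a * c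
  lemma₂ = solve-∀
  a[b-c]≋0 : a * (b - c) ≋ 0ℤ ⟨mod p ⟩
  a[b-c]≋0 = begin
    a * (b - c)        ≡⟨ lemma₂ a b c ⟩
    a * b - a * c      ≈⟨ +-cong-mod ab≋ac (≋-refl {a = - (a * c)}) ⟩
    a * c - a * c      ≡⟨ ℤ.+-inverseʳ (a * c) ⟩
    0ℤ                 ∎

nC0≡1 : ∀ n → n C 0 ≡ 1
nC0≡1 n = begin
  n C 0          ≡⟨ cong (n C_) (ℕ.n∸n≡0 n) ⟨
  n C (n ∸ n)    ≡⟨ nCk≡nC[n∸k] (ℕ.≤-refl {n}) ⟨
  n C n          ≡⟨ nCn≡1 n ⟩
  1              ∎
  where open ≡-Reasoning

[1+k]*[1+n]C[1+k]≡[1+n]*nCk : ∀ n k → suc k ℕ.* (suc n C suc k) ≡ suc n ℕ.* (n C k)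
[1+k]*[1+n]C[1+k]≡[1+n]*nCk zero    zero    = refl
[1+k]*[1+n]C[1+k]≡[1+n]*nCk zero    (suc k) = ℕ.*-zeroʳ (suc (suc k))
[1+k]*[1+n]C[1+k]≡[1+n]*nCk (suc n) zero    = begin
  1 ℕ.* (suc (suc n) C 1)        ≡⟨ ℕ.*-identityˡ (suc (suc n) C 1) ⟩
  suc (suc n) C 1                ≡⟨ nC1≡n (suc (suc n)) ⟩
  suc (suc n)                    ≡⟨ ℕ.*-identityʳ (suc (suc n)) ⟨
  suc (suc n) ℕ.* 1              ≡⟨ cong (suc (suc n) ℕ.*_) (nC0≡1 (suc n)) ⟨
  suc (suc n) ℕ.* (suc n C 0)    ∎
  where open ≡-Reasoning
[1+k]*[1+n]C[1+k]≡[1+n]*nCk (suc n) (suc k) = begin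
  (2 ℕ.+ k) ℕ.* ((2 ℕ.+ n) C (2 ℕ.+ k))
    ≡⟨ cong ((2 ℕ.+ k) ℕ.*_) (nCk+nC[k+1]≡[n+1]C[k+1] (suc n) (suc k)) ⟨
  (2 ℕ.+ k) ℕ.* (c ℕ.+ c′)
    ≡⟨ ℕ.*-distribˡ-+ (2 ℕ.+ k) c c′ ⟩
  c ℕ.+ suc k ℕ.* c ℕ.+ (2 ℕ.+ k) ℕ.* c′
    ≡⟨ cong₂ (λ a b → c ℕ.+ a ℕ.+ b) ([1+k]*[1+n]C[1+k]≡[1+n]*nCk n k)
                                     ([1+k]*[1+n]C[1+k]≡[1+n]*nCk n (suc k)) ⟩
  c ℕ.+ suc n ℕ.* (n C k) ℕ.+ suc n ℕ.* (n C suc k)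
    ≡⟨ ℕ.+-assoc c (suc n ℕ.* (n C k)) (suc n ℕ.* (n C suc k)) ⟩
  c ℕ.+ (suc n ℕ.* (n C k) ℕ.+ suc n ℕ.* (n C suc k))
    ≡⟨ cong (c ℕ.+_) (ℕ.*-distribˡ-+ (suc n) (n C k) (n C suc k)) ⟨
  c ℕ.+ suc n ℕ.* (n C k ℕ.+ n C suc k)
    ≡⟨ cong (λ x → c ℕ.+ suc n ℕ.* x) (nCk+nC[k+1]≡[n+1]C[k+1] n k) ⟩
  c ℕ.+ suc n ℕ.* c
    ∎
  where
  open ≡-Reasoning
  c c′ : ℕ
  c  = suc n C suc k
  c′ = suc n C suc (suc k)

p∣pC[1+k] : ∀ {p} → Prime p → ∀ k → suc k ℕ.< p → p ∣ p C suc k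
p∣pC[1+k] {zero}  ()
p∣pC[1+k] {suc n} p-prime k k<n
  with euclidsLemma (suc k) (suc n C suc k) p-prime
         (divides (n C k) (trans ([1+k]*[1+n]C[1+k]≡[1+n]*nCk n k) (ℕ.*-comm (suc n) (n C k))))
... | inj₁ p∣1+k = contradiction (∣⇒≤ p∣1+k) (ℕ.<⇒≱ k<n)
... | inj₂ p∣C   = p∣C

×ₛ≡* : ∀ n x → n ×ₛ x ≡ + n * x
×ₛ≡* zero    x = refl
×ₛ≡* (suc n) x = trans (cong (_+_ x) (×ₛ≡* n x)) (sym (ℤ.suc-* (+ n) x))

^ₛ≡^ : ∀ x n → x ^ₛ n ≡ x ^ n
^ₛ≡^ x zero    = refl
^ₛ≡^ x (suc n) = cong (x *_) (^ₛ≡^ x n)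

-- Only the two outer terms of the binomial expansion survive modulo p.
frobenius : ∀ {p} → Prime p → ∀ a → (a + 1ℤ) ^ p ≋ a ^ p + 1ℤ ⟨mod p ⟩
frobenius {zero}  ()
frobenius {suc q} p-prime a = begin
  (a + 1ℤ) ^ p                                        ≡⟨ ^ₛ≡^ (a + 1ℤ) p ⟨
  (a + 1ℤ) ^ₛ p                                       ≡⟨ Binomial.theorem p a 1ℤ ⟩
  sum termₛ                                           ≡⟨ sum-cong-≗ termₛ≡term ⟩
  term zero + sum (λ j → term (suc j))
    ≡⟨ cong (_+_ (term zero)) (sum-init-last (λ j → term (suc j))) ⟩
  term zero + (sum middle + term (fromℕ p))
    ≈⟨ +-cong-mod (≋-refl {a = term zero}) (+-cong-mod middle≋0 (≋-refl {a = term (fromℕ p)})) ⟩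
  term zero + (0ℤ + term (fromℕ p))
    ≡⟨ cong₂ (λ x y → x + (0ℤ + y)) term₀≡1 termₚ≡aᵖ ⟩
  1ℤ + (0ℤ + a ^ p)                                   ≡⟨ lemma (a ^ p) ⟩
  a ^ p + 1ℤ                                          ∎
  where
  open ≋-Reasoning (suc q)
  p : ℕ
  p = suc q
  termₛ term : Fin (suc p) → ℤ
  termₛ k = (p C toℕ k) ×ₛ (a ^ₛ toℕ k * 1ℤ ^ₛ (p ∸ toℕ k))
  term  k = + (p C toℕ k) * (a ^ toℕ k * 1ℤ ^ (p ∸ toℕ k))
  termₛ≡term : ∀ k → termₛ k ≡ term k
  termₛ≡term k = trans (×ₛ≡* (p C toℕ k) (a ^ₛ toℕ k * 1ℤ ^ₛ (p ∸ toℕ k)))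
                       (cong (+ (p C toℕ k) *_) (cong₂ _*_ (^ₛ≡^ a (toℕ k)) (^ₛ≡^ 1ℤ (p ∸ toℕ k))))
  term₀≡1 : term zero ≡ 1ℤ
  term₀≡1 = cong₂ (λ c x → + c * (1ℤ * x)) (nC0≡1 p) (ℤ.^-zeroˡ p)
  termₚ≡aᵖ : term (fromℕ p) ≡ a ^ p
  termₚ≡aᵖ rewrite Fin.toℕ-fromℕ q | nCn≡1 p | ℕ.n∸n≡0 q =
    trans (ℤ.*-identityˡ (a ^ p * 1ℤ)) (ℤ.*-identityʳ (a ^ p))
  middle : Fin q → ℤ
  middle j = term (suc (inject₁ j))
  middle≋0 : sum middle ≋ 0ℤ ⟨mod p ⟩
  middle≋0 = ≋-trans (sum-cong-mod {g = λ _ → 0ℤ} λ j →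
               multiple≋0 (a ^ toℕ (suc (inject₁ j)) * 1ℤ ^ (p ∸ toℕ (suc (inject₁ j))))
                 (p∣pC[1+k] p-prime (toℕ (inject₁ j))
                   (ℕ.s≤s (subst (ℕ._< q) (sym (Fin.toℕ-inject₁ j)) (Fin.toℕ<n j)))))
             (≋-reflexive (sum-replicate-zero q))
  lemma : ∀ x → 1ℤ + (0ℤ + x) ≡ x + 1ℤ
  lemma = solve-∀

fermat : ∀ {p} → Prime p → ∀ z → z ^ p ≋ z ⟨mod p ⟩
fermat {zero}      ()
fermat {p@(suc _)} p-prime z = begin
  z ^ p                 ≈⟨ ^-cong-mod p z≋r ⟩
  (+ (z %ℕ p)) ^ p      ≈⟨ fermat-ℕ (z %ℕ p) ⟩
  + (z %ℕ p)            ≈⟨ z≋r ⟨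
  z                     ∎
  where
  open ≋-Reasoning p
  z≋r : z ≋ + (z %ℕ p) ⟨mod p ⟩
  z≋r = ≋-by (z /ℕ p) (a≡a%ℕn+[a/ℕn]*n z p)
  fermat-ℕ : ∀ n → (+ n) ^ p ≋ + n ⟨mod p ⟩
  fermat-ℕ zero    = ≋-refl
  fermat-ℕ (suc n) = begin
    (+ suc n) ^ p         ≡⟨ cong (λ x → (+ x) ^ p) (ℕ.+-comm 1 n) ⟩
    (+ n + 1ℤ) ^ p        ≈⟨ frobenius p-prime (+ n) ⟩
    (+ n) ^ p + 1ℤ        ≈⟨ +-cong-mod (fermat-ℕ n) ≋-refl ⟩
    + n + 1ℤ              ≡⟨ cong +_ (ℕ.+-comm n 1) ⟩
    + suc n               ∎

fermat-unit : ∀ {p z} → Prime p → ¬ z ≋ 0ℤ ⟨mod p ⟩ → z ^ (p ∸ 1) ≋ 1ℤ ⟨mod p ⟩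
fermat-unit {zero}  ()
fermat-unit {suc q} {z} p-prime z≢0 = *-cancelˡ-mod-prime p-prime z≢0 (begin
  z * z ^ q   ≈⟨ fermat p-prime z ⟩
  z           ≡⟨ ℤ.*-identityʳ z ⟨
  z * 1ℤ      ∎)
  where open ≋-Reasoning (suc q)

linear-congruence : ∀ {p d} → Prime p → ¬ d ≋ 0ℤ ⟨mod p ⟩ →
                    ∀ c → Σ ℤ λ s → c + s * d ≋ 0ℤ ⟨mod p ⟩
linear-congruence {zero}        ()
linear-congruence {suc zero}    ()
linear-congruence {suc (suc r)} {d} p-prime d≢0 c = - (c * d ^ r) , (begin
  c + - (c * d ^ r) * d     ≡⟨ lemma₁ c d (d ^ r) ⟩
  c - c * d ^ suc r
    ≈⟨ +-cong-mod (≋-refl {a = c}) (-‿cong-mod (*-cong-mod (≋-refl {a = c}) d^[p-1]≋1)) ⟩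
  c - c * 1ℤ                ≡⟨ lemma₂ c ⟩
  0ℤ                        ∎)
  where
  open ≋-Reasoning (suc (suc r))
  d^[p-1]≋1 : d ^ suc r ≋ 1ℤ ⟨mod suc (suc r) ⟩
  d^[p-1]≋1 = fermat-unit p-prime d≢0
  lemma₁ : ∀ c d e → c + - (c * e) * d ≡ c - c * (d * e)
  lemma₁ = solve-∀
  lemma₂ : ∀ c → c - c * 1ℤ ≡ 0ℤ
  lemma₂ = solve-∀

-- Euler's theorem for prime powers

module _ {ℓ : Level} {P : Pred ℕ ℓ} (P? : Decidable P) where

  private
    #_ : ℕ → ℕ
    # n = length (filter P? (upTo n))

    #-suc : ∀ n → # suc n ≡ # n ℕ.+ length (filter P? [ n ])
    #-suc n = begin
      length (filter P? (upTo (suc n)))                ≡⟨ cong (length ∘ filter P?) (upTo-∷ʳ n) ⟨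
      length (filter P? (upTo n ++ [ n ]))             ≡⟨ cong length (filter-++ P? (upTo n) [ n ]) ⟩
      length (filter P? (upTo n) ++ filter P? [ n ])   ≡⟨ length-++ (filter P? (upTo n)) ⟩
      # n ℕ.+ length (filter P? [ n ])                 ∎
      where open ≡-Reasoning

  length-filter-upTo-accept : ∀ {n} → P n →
                              length (filter P? (upTo (suc n))) ≡ suc (length (filter P? (upTo n)))
  length-filter-upTo-accept {n} Pn = begin
    # suc n                              ≡⟨ #-suc n ⟩
    # n ℕ.+ length (filter P? [ n ])     ≡⟨ cong (λ xs → # n ℕ.+ length xs) (filter-accept P? Pn) ⟩
    # n ℕ.+ 1                            ≡⟨ ℕ.+-comm (# n) 1 ⟩
    suc (# n)                            ∎
    where open ≡-Reasoning

  length-filter-upTo-reject : ∀ {n} → ¬ P n →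
                              length (filter P? (upTo (suc n))) ≡ length (filter P? (upTo n))
  length-filter-upTo-reject {n} ¬Pn = begin
    # suc n                              ≡⟨ #-suc n ⟩
    # n ℕ.+ length (filter P? [ n ])     ≡⟨ cong (λ xs → # n ℕ.+ length xs) (filter-reject P? ¬Pn) ⟩
    # n ℕ.+ 0                            ≡⟨ ℕ.+-identityʳ (# n) ⟩
    # n                                  ∎
    where open ≡-Reasoning

-- As in the definition of φ, the entry i of `upTo n` stands for the number i + 1.
module NonMultiples (q : ℕ) where

  NonMultiple? : Decidable (λ i → ¬ suc q ∣ suc i)
  NonMultiple? i = ¬? (suc q ∣? suc i)

  count : ℕ → ℕ
  count n = length (filter NonMultiple? (upTo n))

  private
    count-block : ∀ m s → s ℕ.≤ q → count (m ℕ.* suc q ℕ.+ s) ≡ count (m ℕ.* suc q) ℕ.+ s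
    count-block m zero    _   =
      trans (cong count (ℕ.+-identityʳ (m ℕ.* suc q))) (sym (ℕ.+-identityʳ (count (m ℕ.* suc q))))
    count-block m (suc s) s<q = begin
      count (m ℕ.* suc q ℕ.+ suc s)      ≡⟨ cong count (ℕ.+-suc (m ℕ.* suc q) s) ⟩
      count (suc (m ℕ.* suc q ℕ.+ s))    ≡⟨ length-filter-upTo-accept NonMultiple? 1+q∤ ⟩
      suc (count (m ℕ.* suc q ℕ.+ s))    ≡⟨ cong suc (count-block m s (ℕ.<⇒≤ s<q)) ⟩
      suc (count (m ℕ.* suc q) ℕ.+ s)    ≡⟨ ℕ.+-suc (count (m ℕ.* suc q)) s ⟨
      count (m ℕ.* suc q) ℕ.+ suc s      ∎
      where
      open ≡-Reasoning
      1+q∤ : ¬ suc q ∣ suc (m ℕ.* suc q ℕ.+ s)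
      1+q∤ 1+q∣ = ℕ.<⇒≱ (ℕ.s≤s s<q)
        (∣⇒≤ (∣m+n∣m⇒∣n (subst (suc q ∣_) (sym (ℕ.+-suc (m ℕ.* suc q) s)) 1+q∣) (n∣m*n m)))

  count-multiple : ∀ m → count (m ℕ.* suc q) ≡ m ℕ.* q
  count-multiple zero    = refl
  count-multiple (suc m) = begin
    count (suc m ℕ.* suc q)            ≡⟨ cong count (sym (lemma m q)) ⟩
    count (suc (m ℕ.* suc q ℕ.+ q))    ≡⟨ length-filter-upTo-reject NonMultiple? (λ 1+q∤ → 1+q∤ 1+q∣) ⟩
    count (m ℕ.* suc q ℕ.+ q)          ≡⟨ count-block m q ℕ.≤-refl ⟩
    count (m ℕ.* suc q) ℕ.+ q          ≡⟨ cong (ℕ._+ q) (count-multiple m) ⟩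
    m ℕ.* q ℕ.+ q                      ≡⟨ ℕ.+-comm (m ℕ.* q) q ⟩
    suc m ℕ.* q                        ∎
    where
    open ≡-Reasoning
    lemma : ∀ m q → suc (m ℕ.* suc q ℕ.+ q) ≡ suc m ℕ.* suc q
    lemma = ℕ-Solver.solve-∀
    1+q∣ : suc q ∣ suc (m ℕ.* suc q ℕ.+ q)
    1+q∣ = divides (suc m) (lemma m q)

coprime-p^[1+k]⇒∤ : ∀ {p n k} → Prime p → Coprime n (p ℕ.^ suc k) → ¬ p ∣ n
coprime-p^[1+k]⇒∤ {p} {k = k} p-prime n⊥p^[1+k] p∣n =
  ¬prime[1] (subst Prime (n⊥p^[1+k] (p∣n , m∣m*n (p ℕ.^ k))) p-prime)

∤⇒coprime-p^k : ∀ {p n k} → Prime p → ¬ p ∣ n → Coprime n (p ℕ.^ k)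
∤⇒coprime-p^k {k = zero}  _       _   (_ , d∣1) = ∣1⇒≡1 d∣1
∤⇒coprime-p^k {p} {n} {suc k} p-prime p∤n {d} (d∣n , d∣p^[1+k]) =
  ∤⇒coprime-p^k {k = k} p-prime p∤n (d∣n , coprime-divisor d⊥p d∣p^[1+k])
  where
  d⊥p : Coprime d p
  d⊥p {e} (e∣d , e∣p) with prime⇒irreducible p-prime e∣p
  ... | inj₁ e≡1  = e≡1
  ... | inj₂ refl = contradiction (∣-trans e∣d d∣n) p∤n

φ-p^[1+k] : ∀ {p} → Prime p → ∀ k → φ (p ℕ.^ suc k) ≡ (p ∸ 1) ℕ.* p ℕ.^ k
φ-p^[1+k] {zero}  ()
φ-p^[1+k] {suc q} p-prime k = begin
  φ (p ℕ.^ suc k)         ≡⟨ cong length (filter-≐ (λ i → coprime? (suc i) (p ℕ.^ suc k)) NonMultiple?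
                                                     coprime⇔∤ (upTo (p ℕ.^ suc k))) ⟩
  count (p ℕ.* p ℕ.^ k)   ≡⟨ cong count (ℕ.*-comm p (p ℕ.^ k)) ⟩
  count (p ℕ.^ k ℕ.* p)   ≡⟨ count-multiple (p ℕ.^ k) ⟩
  p ℕ.^ k ℕ.* q           ≡⟨ ℕ.*-comm (p ℕ.^ k) q ⟩
  q ℕ.* p ℕ.^ k           ∎
  where
  open ≡-Reasoning
  open NonMultiples q
  p : ℕ
  p = suc q
  coprime⇔∤ : (λ i → Coprime (suc i) (p ℕ.^ suc k)) ≐ (λ i → ¬ p ∣ suc i)
  coprime⇔∤ = coprime-p^[1+k]⇒∤ {k = k} p-prime , ∤⇒coprime-p^k {k = suc k} p-prime

φ-p^[1+k]≢0 : ∀ {p} → Prime p → ∀ k → NonZero (φ (p ℕ.^ suc k))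
φ-p^[1+k]≢0 {zero}        ()
φ-p^[1+k]≢0 {suc zero}    ()
φ-p^[1+k]≢0 {suc (suc r)} p-prime k = subst NonZero (sym (φ-p^[1+k] p-prime k))
  (ℕ.m*n≢0 (suc r) (suc (suc r) ℕ.^ k) {{_}} {{ℕ.m^n≢0 (suc (suc r)) k}})

φ-p^[1+k]∣φ-p^[2+k] : ∀ {p} → Prime p → ∀ k → φ (p ℕ.^ suc k) ∣ φ (p ℕ.^ suc (suc k))
φ-p^[1+k]∣φ-p^[2+k] {p} p-prime k = subst₂ _∣_ (sym (φ-p^[1+k] p-prime k)) (sym (φ-p^[1+k] p-prime (suc k)))
  (*-monoʳ-∣ (p ∸ 1) (n∣m*n p))

p∣φ-p^[2+k] : ∀ {p} → Prime p → ∀ k → p ∣ φ (p ℕ.^ suc (suc k))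
p∣φ-p^[2+k] {p} p-prime k =
  subst (p ∣_) (sym (φ-p^[1+k] p-prime (suc k))) (∣n⇒∣m*n (p ∸ 1) (m∣m*n (p ℕ.^ k)))

euler-p^[1+k] : ∀ {p x} → Prime p → ¬ x ≋ 0ℤ ⟨mod p ⟩ → ∀ k →
                x ^ φ (p ℕ.^ suc k) ≋ 1ℤ ⟨mod p ℕ.^ suc k ⟩
euler-p^[1+k] {p} {x} p-prime x≢0 k rewrite φ-p^[1+k] p-prime k = euler k
  where
  euler : ∀ k → x ^ ((p ∸ 1) ℕ.* p ℕ.^ k) ≋ 1ℤ ⟨mod p ℕ.^ suc k ⟩
  euler zero    = subst (λ e → x ^ e ≋ 1ℤ ⟨mod p ℕ.^ 1 ⟩) (sym (ℕ.*-identityʳ (p ∸ 1)))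
                        (≋-mod-∣ {d = p ℕ.^ 1} (∣-reflexive (ℕ.*-identityʳ p)) (fermat-unit p-prime x≢0))
  euler (suc k) = begin
    x ^ ((p ∸ 1) ℕ.* p ℕ.^ suc k)      ≡⟨ cong (x ^_) (lemma (p ∸ 1) p (p ℕ.^ k)) ⟩
    x ^ ((p ∸ 1) ℕ.* p ℕ.^ k ℕ.* p)    ≡⟨ ℤ.^-*-assoc x ((p ∸ 1) ℕ.* p ℕ.^ k) p ⟨
    (x ^ ((p ∸ 1) ℕ.* p ℕ.^ k)) ^ p    ≈⟨ ^-≋1-lift p (m∣m*n (p ℕ.^ k)) (euler k) ⟩
    1ℤ                                 ∎
    where
    open ≋-Reasoning (p ℕ.^ suc (suc k))
    lemma : ∀ a p n → a ℕ.* (p ℕ.* n) ≡ a ℕ.* n ℕ.* p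
    lemma = ℕ-Solver.solve-∀

module _ (M : ℕ → ℕ) (M-∣ : ∀ k → M k ∣ M (suc k)) where

  ∣-chain : ∀ {k n} → k ≤′ n → M k ∣ M n
  ∣-chain ≤′-refl        = ∣-refl
  ∣-chain (≤′-step k≤n) = ∣-trans (∣-chain k≤n) (M-∣ _)

  ≋-chain : (s : ℕ → ℤ) → (∀ k → s (suc k) ≋ s k ⟨mod M k ⟩) →
            ∀ {k n} → k ≤′ n → s n ≋ s k ⟨mod M k ⟩
  ≋-chain s s-coherent ≤′-refl        = ≋-refl
  ≋-chain s s-coherent (≤′-step k≤n) =
    ≋-trans (≋-mod-∣ (∣-chain k≤n) (s-coherent _)) (≋-chain s s-coherent k≤n)

coh-≋ : ∀ {p} (x : Zp p) k → seq x (suc k) ≋ seq x k ⟨mod p ℕ.^ suc k ⟩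
coh-≋ x k = ≡[mod]⇒≋ (coh x k)

ecoh-≋ : ∀ {p} (β : Ep p) k → eseq β (suc k) ≋ eseq β k ⟨mod φ (p ℕ.^ suc k) ⟩
ecoh-≋ β k = ≡[mod]⇒≋ (ecoh β k)

seq-≋ : ∀ {p} (x : Zp p) {k n} → k ≤′ n → seq x n ≋ seq x k ⟨mod p ℕ.^ suc k ⟩
seq-≋ {p} x = ≋-chain (λ k → p ℕ.^ suc k) (λ k → n∣m*n p) (seq x) (coh-≋ x)

eseq-≋ : ∀ {p} → Prime p → (β : Ep p) → ∀ {k n} → k ≤′ n →
         eseq β n ≋ eseq β k ⟨mod φ (p ℕ.^ suc k) ⟩
eseq-≋ {p} p-prime β =
  ≋-chain (λ k → φ (p ℕ.^ suc k)) (φ-p^[1+k]∣φ-p^[2+k] p-prime) (eseq β) (ecoh-≋ β)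

expMod-≋ : ∀ α m .{{_ : NonZero m}} → + expMod α m ≋ α ⟨mod m ⟩
expMod-≋ α (suc m) = ≋-sym (≋-by (α /ℕ suc m) (a≡a%ℕn+[a/ℕn]*n α (suc m)))

-- Hensel lifting

module HenselLifting
  {p : ℕ} (p-prime : Prime p)
  (F D : ℕ → ℤ → ℤ) (y : ℕ → ℤ) (x₁ : ℤ)
  (F-taylor : ∀ i {m} z h → h * h ≋ 0ℤ ⟨mod m ⟩ → F i (z + h) ≋ F i z + h * D i z ⟨mod m ⟩)
  (F-coherent : ∀ i {z} → z ≋ x₁ ⟨mod p ⟩ → F (suc i) z ≋ F i z ⟨mod p ℕ.^ suc i ⟩)
  (D-unit : ∀ i {z} → z ≋ x₁ ⟨mod p ⟩ → ¬ D (suc i) z ≋ 0ℤ ⟨mod p ⟩)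
  (y-coherent : ∀ i → y (suc i) ≋ y i ⟨mod p ℕ.^ suc i ⟩)
  (x₁-root : F 0 x₁ ≋ y 0 ⟨mod p ⟩)
  where

  IsLift : ℕ → ℤ → Set
  IsLift i z = z ≋ x₁ ⟨mod p ⟩ × F i z ≋ y i ⟨mod p ℕ.^ suc i ⟩

  private
    p∣p^[1+i] : ∀ i → p ∣ p ℕ.^ suc i
    p∣p^[1+i] i = m∣m*n (p ℕ.^ i)

    p^[1+i]≢0 : ∀ i → NonZero (p ℕ.^ suc i)
    p^[1+i]≢0 i = ℕ.m^n≢0 p (suc i) {{prime⇒nonZero p-prime}}

    [p^[1+i]*s]²≋0 : ∀ i s → + (p ℕ.^ suc i) * s * (+ (p ℕ.^ suc i) * s) ≋ 0ℤ ⟨mod p ℕ.^ suc (suc i) ⟩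
    [p^[1+i]*s]²≋0 i s = *-≋0 (multiple≋0 s (p∣p^[1+i] i)) (≋0-by s (ℤ.*-comm (+ (p ℕ.^ suc i)) s))

  -- Newton's step: if F z = y + c * p ^ (i + 1), take z + p ^ (i + 1) * s with c + s * D z ≡ 0 modulo p.
  lift-step : ∀ {i z} → IsLift i z → Σ ℤ λ z′ → IsLift (suc i) z′ × z′ ≋ z ⟨mod p ℕ.^ suc i ⟩
  lift-step {i} {z} (z≋x₁ , Fz≋y) =
    step (≋-trans (F-coherent i z≋x₁) (≋-trans Fz≋y (≋-sym (y-coherent i))))
    where
    P : ℕ
    P = p ℕ.^ suc i
    step : F (suc i) z ≋ y (suc i) ⟨mod P ⟩ → Σ ℤ λ z′ → IsLift (suc i) z′ × z′ ≋ z ⟨mod P ⟩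
    step (≋-by c Fz≡y+cP) with s , c+sd≋0 ← linear-congruence p-prime (D-unit i z≋x₁) c =
      z + + P * s , (z′≋x₁ , Fz′≋y) , ≋-by s (cong (_+_ z) (ℤ.*-comm (+ P) s))
      where
      d : ℤ
      d = D (suc i) z
      z′≋x₁ : z + + P * s ≋ x₁ ⟨mod p ⟩
      z′≋x₁ = ≋-trans (+-cong-mod (≋-refl {a = z}) (multiple≋0 s (p∣p^[1+i] i)))
                      (≋-trans (≋-reflexive (ℤ.+-identityʳ z)) z≋x₁)
      Fz′≋y : F (suc i) (z + + P * s) ≋ y (suc i) ⟨mod p ℕ.* P ⟩
      Fz′≋y = begin
        F (suc i) (z + + P * s)            ≈⟨ F-taylor (suc i) z (+ P * s) ([p^[1+i]*s]²≋0 i s) ⟩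
        F (suc i) z + + P * s * d          ≡⟨ cong (λ x → x + + P * s * d) Fz≡y+cP ⟩
        y (suc i) + c * + P + + P * s * d  ≡⟨ lemma₁ (y (suc i)) c (+ P) s d ⟩
        y (suc i) + + P * (c + s * d)      ≈⟨ +-cong-mod (≋-refl {a = y (suc i)}) (*-scaleˡ-mod P c+sd≋0) ⟩
        y (suc i) + + P * 0ℤ               ≡⟨ lemma₂ (y (suc i)) (+ P) ⟩
        y (suc i)                          ∎
        where
        open ≋-Reasoning (p ℕ.* P)
        lemma₁ : ∀ y c P s d → y + c * P + P * s * d ≡ y + P * (c + s * d)
        lemma₁ = solve-∀
        lemma₂ : ∀ y P → y + P * 0ℤ ≡ y
        lemma₂ = solve-∀

  -- Two lifts z and z + p ^ (i + 1) * s differ in F by p ^ (i + 1) * s * D z modulo p ^ (i + 2),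
  -- and D z is invertible modulo p, so p ∣ s.
  lift-unique : ∀ {i z z′} → IsLift (suc i) z → F (suc i) z′ ≋ y (suc i) ⟨mod p ℕ.^ suc (suc i) ⟩ →
                z′ ≋ z ⟨mod p ℕ.^ suc i ⟩ → z′ ≋ z ⟨mod p ℕ.^ suc (suc i) ⟩
  lift-unique {i} {z} (z≋x₁ , Fz≋y) Fz′≋y (≋-by s refl) = begin
    z + s * + P          ≡⟨ cong (_+_ z) (ℤ.*-comm s (+ P)) ⟩
    z + + P * s          ≈⟨ +-cong-mod (≋-refl {a = z}) (*-scaleˡ-mod P s≋0) ⟩
    z + + P * 0ℤ         ≡⟨ cong (_+_ z) (ℤ.*-zeroʳ (+ P)) ⟩
    z + 0ℤ               ≡⟨ ℤ.+-identityʳ z ⟩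
    z                    ∎
    where
    open ≋-Reasoning (p ℕ.* p ℕ.^ suc i)
    P : ℕ
    P = p ℕ.^ suc i
    d : ℤ
    d = D (suc i) z
    Fz+Pds≋Fz+0 : F (suc i) z + + P * (d * s) ≋ F (suc i) z + + P * 0ℤ ⟨mod p ℕ.* P ⟩
    Fz+Pds≋Fz+0 = begin
      F (suc i) z + + P * (d * s)    ≡⟨ cong (_+_ (F (suc i) z)) (lemma₁ (+ P) s d) ⟩
      F (suc i) z + + P * s * d      ≈⟨ F-taylor (suc i) z (+ P * s) ([p^[1+i]*s]²≋0 i s) ⟨
      F (suc i) (z + + P * s)        ≡⟨ cong (λ h → F (suc i) (z + h)) (ℤ.*-comm (+ P) s) ⟩
      F (suc i) (z + s * + P)        ≈⟨ Fz′≋y ⟩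
      y (suc i)                      ≈⟨ Fz≋y ⟨
      F (suc i) z                    ≡⟨ lemma₂ (F (suc i) z) (+ P) ⟩
      F (suc i) z + + P * 0ℤ         ∎
      where
      lemma₁ : ∀ P s d → P * (d * s) ≡ P * s * d
      lemma₁ = solve-∀
      lemma₂ : ∀ f P → f ≡ f + P * 0ℤ
      lemma₂ = solve-∀
    s≋0 : s ≋ 0ℤ ⟨mod p ⟩
    s≋0 = ≢0*≋0⇒≋0 p-prime (D-unit i z≋x₁)
            (*-unscaleˡ-mod P {{p^[1+i]≢0 i}} (+-cancelˡ-mod (F (suc i) z) Fz+Pds≋Fz+0))

  private
    p^1∣p : p ℕ.^ 1 ∣ p
    p^1∣p = ∣-reflexive (ℕ.*-identityʳ p)

    lift : ∀ i → Σ ℤ (IsLift i)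
    lift zero    = x₁ , ≋-refl , ≋-mod-∣ p^1∣p x₁-root
    lift (suc i) = map₂ proj₁ (lift-step (proj₂ (lift i)))

  root : ℕ → ℤ
  root i = proj₁ (lift i)

  root-isLift : ∀ i → IsLift i (root i)
  root-isLift i = proj₂ (lift i)

  root-coherent : ∀ i → root (suc i) ≋ root i ⟨mod p ℕ.^ suc i ⟩
  root-coherent i = proj₂ (proj₂ (lift-step (root-isLift i)))

  root-unique : (v : ℕ → ℤ) → v 0 ≋ x₁ ⟨mod p ⟩ →
                (∀ i → v (suc i) ≋ v i ⟨mod p ℕ.^ suc i ⟩) →
                (∀ i → F i (v i) ≋ y i ⟨mod p ℕ.^ suc i ⟩) →
                ∀ i → v i ≋ root i ⟨mod p ℕ.^ suc i ⟩
  root-unique v v₀≋x₁ v-coherent v-root zero    = ≋-mod-∣ p^1∣p v₀≋x₁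
  root-unique v v₀≋x₁ v-coherent v-root (suc i) =
    lift-unique (root-isLift (suc i)) (v-root (suc i))
      (≋-trans (v-coherent i)
        (≋-trans (root-unique v v₀≋x₁ v-coherent v-root i) (≋-sym (root-coherent i))))

module ExponentialSum {p : ℕ} (p-prime : Prime p) {t : ℕ} (a : Fin t → Zp p) (α : Fin t → Ep p) where

  fₚ : Seq → Seq
  fₚ = fˢ p t (λ j → seq (a j)) (λ j → eseq (α j))

  exponent : Fin t → ℕ → ℕ
  exponent j i = expMod (eseq (α j) i) (φ (p ℕ.^ suc i))

  exponent-≋ : ∀ j i → + exponent j i ≋ eseq (α j) i ⟨mod φ (p ℕ.^ suc i) ⟩
  exponent-≋ j i = expMod-≋ (eseq (α j) i) (φ (p ℕ.^ suc i)) {{φ-p^[1+k]≢0 p-prime i}}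

  f f′ : ℕ → ℤ → ℤ
  f  i z = sum λ j → seq (a j) i * z ^ exponent j i
  f′ i z = sum λ j → seq (a j) i * powDeriv (exponent j i) z

  fₚ≡f : ∀ x i → fₚ x i ≡ f i (x i)
  fₚ≡f x i = sumˢ-sum t (λ j → seq (a j) *ˢ powˢ p x (eseq (α j))) i

  f≋⇒fₚ≈ : ∀ {v w} → (∀ i → f i (v i) ≋ w i ⟨mod p ℕ.^ suc i ⟩) → fₚ v ≈[ p ] w
  f≋⇒fₚ≈ {v} f≋ i = ≋⇒≡[mod] (≋-trans (≋-reflexive (fₚ≡f v i)) (f≋ i))

  fₚ≈⇒f≋ : ∀ {v w} → fₚ v ≈[ p ] w → ∀ i → f i (v i) ≋ w i ⟨mod p ℕ.^ suc i ⟩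
  fₚ≈⇒f≋ {v} fₚ≈ i = ≋-trans (≋-reflexive (sym (fₚ≡f v i))) (≡[mod]⇒≋ (fₚ≈ i))

  f-taylor : ∀ i {m} z h → h * h ≋ 0ℤ ⟨mod m ⟩ → f i (z + h) ≋ f i z + h * f′ i z ⟨mod m ⟩
  f-taylor i {m} z h h²≋0 = ≋-trans (sum-cong-mod term-taylor) (≋-reflexive (sum-+-* u d h))
    where
    u d : Fin t → ℤ
    u j = seq (a j) i * z ^ exponent j i
    d j = seq (a j) i * powDeriv (exponent j i) z
    lemma : ∀ a x d h → a * (x + d * h) ≡ a * x + h * (a * d)
    lemma = solve-∀
    term-taylor : ∀ j → seq (a j) i * (z + h) ^ exponent j i ≋ u j + h * d j ⟨mod m ⟩
    term-taylor j =
      ≋-trans (*-cong-mod (≋-refl {a = seq (a j) i}) (^-first-order-mod z (exponent j i) h²≋0))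
              (≋-reflexive (lemma (seq (a j) i) (z ^ exponent j i) (powDeriv (exponent j i) z) h))

  f-coherent : ∀ i {z} → ¬ z ≋ 0ℤ ⟨mod p ⟩ → f (suc i) z ≋ f i z ⟨mod p ℕ.^ suc i ⟩
  f-coherent i z≢0 = sum-cong-mod λ j →
    *-cong-mod (coh-≋ (a j) i) (^-cong-exponent (euler-p^[1+k] p-prime z≢0 i) (exponent-coherent j))
    where
    exponent-coherent : ∀ j → + exponent j (suc i) ≋ + exponent j i ⟨mod φ (p ℕ.^ suc i) ⟩
    exponent-coherent j = ≋-trans (≋-mod-∣ (φ-p^[1+k]∣φ-p^[2+k] p-prime i) (exponent-≋ j (suc i)))
                                  (≋-trans (ecoh-≋ (α j) i) (≋-sym (exponent-≋ j i)))

  -- The exponent e of level i + 1 satisfies e ≡ α_{j2} modulo p, because p ∣ φ (p ^ 2),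
  -- and e - 1 ≡ α_{j1} - 1 modulo φ p.
  f′≋f′ˢ : ∀ i {x₁ z} → ¬ x₁ ≋ 0ℤ ⟨mod p ⟩ → z ≋ x₁ ⟨mod p ⟩ →
           f′ (suc i) z ≋ f'ˢ p t (λ j → seq (a j)) (λ j → eseq (α j)) (const x₁) 0 ⟨mod p ⟩
  f′≋f′ˢ i {x₁} {z} x₁≢0 z≋x₁ = ≋-trans (sum-cong-mod term≋) (≋-reflexive (sym (sumˢ-sum t _ 0)))
    where
    p∣p^1 : p ∣ p ℕ.^ 1
    p∣p^1 = m∣m*n 1
    term≋ : ∀ j → seq (a j) (suc i) * powDeriv (exponent j (suc i)) z
                  ≋ seq (a j) 0 * eseq (α j) 1 * x₁ ^ expMod (eseq (α j) 0 - 1ℤ) (φ (p ℕ.^ 1)) ⟨mod p ⟩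
    term≋ j = ≋-trans (*-cong-mod (≋-mod-∣ p∣p^1 (seq-≋ (a j) ℕ.z≤′n))
                                  (powDeriv-cong-mod z≋x₁ x₁^φ[p]≋1 e≋α₁ e-1≋e′))
                      (≋-reflexive (sym (ℤ.*-assoc (seq (a j) 0) (eseq (α j) 1) (x₁ ^ e′))))
      where
      e e′ : ℕ
      e  = exponent j (suc i)
      e′ = expMod (eseq (α j) 0 - 1ℤ) (φ (p ℕ.^ 1))
      x₁^φ[p]≋1 : x₁ ^ φ (p ℕ.^ 1) ≋ 1ℤ ⟨mod p ⟩
      x₁^φ[p]≋1 = ≋-mod-∣ p∣p^1 (euler-p^[1+k] p-prime x₁≢0 0)
      e≋α₁ : + e ≋ eseq (α j) 1 ⟨mod p ⟩
      e≋α₁ = ≋-trans (≋-mod-∣ (p∣φ-p^[2+k] p-prime i) (exponent-≋ j (suc i)))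
                     (≋-mod-∣ (p∣φ-p^[2+k] p-prime 0) (eseq-≋ p-prime (α j) (ℕ.s≤′s ℕ.z≤′n)))
      φ[p]∣φ[p^[2+i]] : φ (p ℕ.^ 1) ∣ φ (p ℕ.^ suc (suc i))
      φ[p]∣φ[p^[2+i]] = ∣-chain (λ k → φ (p ℕ.^ suc k)) (φ-p^[1+k]∣φ-p^[2+k] p-prime) (ℕ.z≤′n {suc i})
      e≋α₀ : + e ≋ eseq (α j) 0 ⟨mod φ (p ℕ.^ 1) ⟩
      e≋α₀ = ≋-trans (≋-mod-∣ φ[p]∣φ[p^[2+i]] (exponent-≋ j (suc i))) (eseq-≋ p-prime (α j) ℕ.z≤′n)
      e-1≋e′ : + e - 1ℤ ≋ + e′ ⟨mod φ (p ℕ.^ 1) ⟩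
      e-1≋e′ = ≋-trans (+-cong-mod e≋α₀ (≋-refl {a = - 1ℤ}))
                       (≋-sym (expMod-≋ (eseq (α j) 0 - 1ℤ) (φ (p ℕ.^ 1)) {{φ-p^[1+k]≢0 p-prime 0}}))

proposition2p8 : (p : ℕ) → Prime p → ¬ (2 ∣ p) → (t : ℕ)
    → (y : Zp p) → (a : Fin t → Zp p) → (α : Fin t → Ep p)
    → (x₁ : ℤ) → ¬ ((+ p) ∣ℤ x₁)
    → fˢ p t (λ j → seq (a j)) (λ j → eseq (α j)) (const x₁) 0 ≡ seq y 0 [mod p ]
    → ¬ (f'ˢ p t (λ j → seq (a j)) (λ j → eseq (α j)) (const x₁) 0 ≡ + 0 [mod p ])
    → Σ (Zp p) (λ x →
        (IsUnit p x × seq x 0 ≡ x₁ [mod p ]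
          × fˢ p t (λ j → seq (a j)) (λ j → eseq (α j)) (seq x) ≈[ p ] seq y)
        × ((x' : Zp p) → IsUnit p x' → seq x' 0 ≡ x₁ [mod p ]
          → fˢ p t (λ j → seq (a j)) (λ j → eseq (α j)) (seq x') ≈[ p ] seq y
          → seq x' ≈[ p ] seq x))
proposition2p8 p p-prime _ t y a α x₁ p∤x₁ f[x₁]≡y₀ f′[x₁]≢0 =
  x , (≢0-resp-≋ root₀≋x₁ x₁≢0 ∘ ∣⇒≋0 , ≋⇒≡[mod] root₀≋x₁ , f≋⇒fₚ≈ (proj₂ ∘ root-isLift)) ,
  λ x′ _ x′₀≡x₁ fₚ[x′]≈y i →
    ≋⇒≡[mod] (root-unique (seq x′) (≡[mod]⇒≋ x′₀≡x₁) (coh-≋ x′) (fₚ≈⇒f≋ fₚ[x′]≈y) i)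
  where
  open ExponentialSum p-prime a α
  x₁≢0 : ¬ x₁ ≋ 0ℤ ⟨mod p ⟩
  x₁≢0 x₁≋0 = p∤x₁ (≋0⇒∣ x₁≋0)
  f-coherent-near-x₁ : ∀ i {z} → z ≋ x₁ ⟨mod p ⟩ → f (suc i) z ≋ f i z ⟨mod p ℕ.^ suc i ⟩
  f-coherent-near-x₁ i z≋x₁ = f-coherent i (≢0-resp-≋ z≋x₁ x₁≢0)
  f′-unit-near-x₁ : ∀ i {z} → z ≋ x₁ ⟨mod p ⟩ → ¬ f′ (suc i) z ≋ 0ℤ ⟨mod p ⟩
  f′-unit-near-x₁ i z≋x₁ f′≋0 =
    f′[x₁]≢0 (≋⇒≡[mod] (≋-trans (≋-sym (f′≋f′ˢ i x₁≢0 z≋x₁)) f′≋0))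
  x₁-root : f 0 x₁ ≋ seq y 0 ⟨mod p ⟩
  x₁-root = ≋-trans (≋-reflexive (sym (fₚ≡f (const x₁) 0))) (≡[mod]⇒≋ f[x₁]≡y₀)
  open HenselLifting p-prime f f′ (seq y) x₁ f-taylor f-coherent-near-x₁ f′-unit-near-x₁ (coh-≋ y) x₁-root
  x : Zp p
  x = mkZp root (λ i → ≋⇒≡[mod] (root-coherent i))
  root₀≋x₁ : root 0 ≋ x₁ ⟨mod p ⟩
  root₀≋x₁ = proj₁ (root-isLift 0)
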